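{- Let $G$ be a $2$-tree, let $\ell$ be the length (number of edges) of a longest path of $G$, let $\mathcal T$ be an SPQ-tree of $G$, and let $h$ be the height of $\mathcal T$. Then $h\leq 2\ell-2$.
   Context: A $2$-tree is defined recursively: a $3$-cycle is a $2$-tree, and adding to a $2$-tree a new vertex adjacent to both endpoints of an existing edge yields a $2$-tree. SPQ-trees of series-parallel graphs with two poles are defined recursively: an edge is a Q-node; a parallel composition (identifying all first poles and all second poles of $G_1,\dots,G_k$) is a P-node with the SPQ-trees of the $G_i$ as children; a series composition (identifying the second pole of $G_i$ with the first pole of $G_{i+1}$) is an S-node with the SPQ-trees of the $G_i$ as children. An SPQ-tree of a $2$-tree $G$ here is one such that the root is a P-node, every P-node has at least two children, exactly one being a Q-node and the others S-nodes, and every S-node has exactly two children, each a Q-node or a P-node. The height is the maximum number of edges on a root-to-leaf path. -}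

module Defs where

open import Data.Nat using (ℕ; zero; suc; _⊔_)
open import Data.Fin using (Fin; zero; suc)
open import Data.Bool using (Bool; true; false)
open import Data.Unit using (⊤; tt)
open import Data.Empty using (⊥)
open import Data.Sum using (_⊎_; inj₁; inj₂)
open import Data.Product using (Σ; _×_; _,_)
open import Data.List using (List; []; _∷_; length)
open import Data.List.Relation.Unary.Linked using (Linked)
open import Data.List.Relation.Unary.Unique.Propositional using (Unique)
open import Relation.Binary.PropositionalEquality using (_≡_; _≢_)
open import Function.Bundles using (_↔_; _⇔_; Inverse)

record Graph : Set₁ where
  field
    V : Set
    E : V → V → Set

open Graph public

_≅_ : Graph → Graph → Set
G ≅ H = Σ (V G ↔ V H) λ f →
          ∀ x y → E G x y ⇔ E H (Inverse.to f x) (Inverse.to f y)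

-- 2-trees, with vertex set Fin n (labelled; the statement is invariant
-- under isomorphism).  A 3-cycle is a 2-tree; adding a new vertex
-- (here: `zero`, old vertices shifted by `suc`) adjacent to both
-- endpoints of an existing edge uv yields a 2-tree.

triangleAdj : Fin 3 → Fin 3 → Set
triangleAdj x y = x ≢ y

extendAdj : ∀ {n} → (Fin n → Fin n → Set) → Fin n → Fin n →
            Fin (suc n) → Fin (suc n) → Set
extendAdj E u v zero    zero    = ⊥
extendAdj E u v zero    (suc y) = (y ≡ u) ⊎ (y ≡ v)
extendAdj E u v (suc x) zero    = (x ≡ u) ⊎ (x ≡ v)
extendAdj E u v (suc x) (suc y) = E x y

data TwoTree : (n : ℕ) → (Fin n → Fin n → Set) → Set₁ where
  triangle : TwoTree 3 triangleAdj
  extend   : ∀ {n E} → TwoTree n E → (u v : Fin n) → E u v →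
             TwoTree (suc n) (extendAdj E u v)

record Path {n : ℕ} (E : Fin n → Fin n → Set) : Set where
  field
    start  : Fin n
    rest   : List (Fin n)
    unique : Unique (start ∷ rest)
    linked : Linked E (start ∷ rest)

pathLength : ∀ {n} {E : Fin n → Fin n → Set} → Path E → ℕ
pathLength p = length (Path.rest p)

IsLongestPathLength : ∀ {n} (E : Fin n → Fin n → Set) → ℕ → Set
IsLongestPathLength E ℓ =
  Σ (Path E) (λ p → pathLength p ≡ ℓ) × (∀ (p : Path E) → pathLength p Data.Nat.≤ ℓ)

-- SPQ-trees of 2-trees (restricted form): a P-node has exactly one
-- Q-child and at least one S-child (`pnode s ss` has S-children s ∷ ss);
-- an S-node has exactly two children, each a Q-node or a P-node.

mutual
  data PNode : Set where
    pnode : SNode → List SNode → PNode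

  data SNode : Set where
    snode : Child → Child → SNode

  data Child : Set where
    qleaf : Child
    pchild : PNode → Child

mutual
  heightP : PNode → ℕ
  heightP (pnode s ss) = suc (heightS s ⊔ heightL ss)

  heightL : List SNode → ℕ
  heightL []       = 0
  heightL (s ∷ ss) = heightS s ⊔ heightL ss

  heightS : SNode → ℕ
  heightS (snode a b) = suc (heightC a ⊔ heightC b)

  heightC : Child → ℕ
  heightC qleaf      = 0
  heightC (pchild p) = heightP p

-- Vertices are `inj₁ false` (first
-- pole), `inj₁ true` (second pole), or `inj₂ i` for an internal vertex i.
-- Internal vertices of an S-node: those of the first child, the middle
-- vertex (identified second/first pole), those of the second child.
mutual
  IntP : PNode → Set
  IntP (pnode s ss) = IntS s ⊎ IntL ss

  IntL : List SNode → Set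
  IntL []       = ⊥
  IntL (s ∷ ss) = IntS s ⊎ IntL ss

  IntS : SNode → Set
  IntS (snode a b) = IntC a ⊎ (⊤ ⊎ IntC b)

  IntC : Child → Set
  IntC qleaf      = ⊥
  IntC (pchild p) = IntP p

Image : {A B : Set} → (A → B) → (A → A → Set) → B → B → Set
Image {A} f R x y = Σ A λ u → Σ A λ w → R u w × (f u ≡ x) × (f w ≡ y)

PoleEdge : {I : Set} → Bool ⊎ I → Bool ⊎ I → Set
PoleEdge x y = ((x ≡ inj₁ false) × (y ≡ inj₁ true))
             ⊎ ((x ≡ inj₁ true) × (y ≡ inj₁ false))

embHead : {I J : Set} → Bool ⊎ I → Bool ⊎ (I ⊎ J)
embHead (inj₁ b) = inj₁ b
embHead (inj₂ i) = inj₂ (inj₁ i)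

embTail : {I J : Set} → Bool ⊎ J → Bool ⊎ (I ⊎ J)
embTail (inj₁ b) = inj₁ b
embTail (inj₂ j) = inj₂ (inj₂ j)

-- series: first child (poles s, m), second child (poles m, t)
embLeft : {I J : Set} → Bool ⊎ I → Bool ⊎ (I ⊎ (⊤ ⊎ J))
embLeft (inj₁ false) = inj₁ false
embLeft (inj₁ true)  = inj₂ (inj₂ (inj₁ tt))
embLeft (inj₂ i)     = inj₂ (inj₁ i)

embRight : {I J : Set} → Bool ⊎ J → Bool ⊎ (I ⊎ (⊤ ⊎ J))
embRight (inj₁ false) = inj₂ (inj₂ (inj₁ tt))
embRight (inj₁ true)  = inj₁ true
embRight (inj₂ j)     = inj₂ (inj₂ (inj₂ j))

mutual
  -- P-node: parallel composition of its Q-child and S-children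
  EdgeP : (p : PNode) → Bool ⊎ IntP p → Bool ⊎ IntP p → Set
  EdgeP (pnode s ss) x y =
    PoleEdge x y ⊎ (Image embHead (EdgeS s) x y ⊎ Image embTail (EdgeL ss) x y)

  EdgeL : (ss : List SNode) → Bool ⊎ IntL ss → Bool ⊎ IntL ss → Set
  EdgeL []       x y = ⊥
  EdgeL (s ∷ ss) x y = Image embHead (EdgeS s) x y ⊎ Image embTail (EdgeL ss) x y

  EdgeS : (s : SNode) → Bool ⊎ IntS s → Bool ⊎ IntS s → Set
  EdgeS (snode a b) x y = Image embLeft (EdgeC a) x y ⊎ Image embRight (EdgeC b) x y

  EdgeC : (c : Child) → Bool ⊎ IntC c → Bool ⊎ IntC c → Set
  EdgeC qleaf      x y = PoleEdge x y
  EdgeC (pchild p) x y = EdgeP p x y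

spqGraph : PNode → Graph
spqGraph p = record { V = Bool ⊎ IntP p ; E = EdgeP p }

finGraph : (n : ℕ) → (Fin n → Fin n → Set) → Graph
finGraph n E = record { V = Fin n ; E = E }

IsSPQTreeOf : PNode → Graph → Set
IsSPQTreeOf T G = spqGraph T ≅ G

-- Every node of the SPQ-tree has, in its pertinent graph, a path between its two poles
-- with at least half as many interior vertices as the node is high.  A Q-node has the
-- pole edge; an S-node with children of heights hₐ, h_b ≤ 2kₐ, 2k_b concatenates the
-- two children's paths through the middle vertex, getting kₐ + k_b + 1 interior
-- vertices for height at most 1 + max(hₐ, h_b) ≤ 2(kₐ + k_b + 1) − 1; a P-node keeps
-- the path of its tallest S-child, which is one level lower and so has slack 1.  At
-- the root this is a path of length k + 1 ≤ ℓ with h ≤ 2k ≤ 2ℓ − 2.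
module Submission where

open import Defs
open import Data.Nat using (ℕ; _≤_; _*_; _∸_; _+_; _⊔_; suc; z≤n)
open import Data.Nat.Properties
open import Data.Nat.Tactic.RingSolver using (solve-∀)
open import Data.Fin using (Fin)
open import Data.Bool using (Bool; true; false)
open import Data.Unit using (tt)
open import Data.Sum using (_⊎_; inj₁; inj₂)
open import Data.Sum.Properties using (inj₁-injective; inj₂-injective)
open import Data.Product using (Σ-syntax; _,_)
open import Data.List using (List; []; _∷_; map; _++_; length)
open import Data.List.Properties using (length-map; length-++; map-∘)
open import Data.List.Membership.Propositional.Properties using (∈-map⁻)
open import Data.List.Relation.Unary.All as All using (All; []; _∷_)
import Data.List.Relation.Unary.All.Properties as All
open import Data.List.Relation.Unary.Linked using (Linked; [-]; _∷_)
import Data.List.Relation.Unary.Linked as Linked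
import Data.List.Relation.Unary.Linked.Properties as Linked
open import Data.List.Relation.Unary.Unique.Propositional using (Unique)
import Data.List.Relation.Unary.Unique.Propositional.Properties as Unique
open import Data.List.Relation.Binary.Disjoint.Propositional using (Disjoint)
import Data.List.Relation.Binary.Disjoint.Propositional.Properties as Disjoint
open import Data.List.Relation.Unary.AllPairs using ([]; _∷_)
open import Function using (_∘_)
open import Function.Bundles using (Inverse; Equivalence; Injection)
open import Function.Definitions using (Injective)
open import Function.Properties.Inverse using (↔⇒↣)
open import Relation.Binary.PropositionalEquality
  using (_≡_; _≢_; refl; sym; cong; cong₂; subst; module ≡-Reasoning)

private
  variable
    A B I J : Set

inj₁-inj₂-disjoint : (xs : List A) (ys : List B) → Disjoint (map inj₁ xs) (map inj₂ ys)
inj₁-inj₂-disjoint xs ys (v∈xs , v∈ys) with ∈-map⁻ inj₁ v∈xs | ∈-map⁻ inj₂ v∈ys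
... | _ , _ , refl | _ , _ , ()

unique-inj₁-++-inj₂ : {xs : List A} {ys : List B} → Unique xs → Unique ys →
                      Unique (map inj₁ xs ++ map inj₂ ys)
unique-inj₁-++-inj₂ {xs = xs} {ys} uxs uys =
  Unique.++⁺ (Unique.map⁺ inj₁-injective uxs) (Unique.map⁺ inj₂-injective uys)
             (inj₁-inj₂-disjoint xs ys)

Linked-image : {R : A → A → Set} (g : A → B) {xs : List A} →
               Linked R xs → Linked (Image g R) (map g xs)
Linked-image g = Linked.map⁺ ∘ Linked.map (λ {x} {y} r → x , y , r , refl , refl)

route : A ⊎ I → List I → A ⊎ I → List (A ⊎ I)
route s xs t = s ∷ map inj₂ xs ++ t ∷ []

map-route : (g : A ⊎ I → B ⊎ J) (f : I → J) → (∀ i → g (inj₂ i) ≡ inj₂ (f i)) →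
            ∀ s xs t → map g (route s xs t) ≡ route (g s) (map f xs) (g t)
map-route g f g-inj₂ s []       t = refl
map-route g f g-inj₂ s (x ∷ xs) t = cong (g s ∷_) (begin
  map g (route (inj₂ x) xs t)            ≡⟨ map-route g f g-inj₂ (inj₂ x) xs t ⟩
  route (g (inj₂ x)) (map f xs) (g t)    ≡⟨ cong (λ v → route v (map f xs) (g t)) (g-inj₂ x) ⟩
  route (inj₂ (f x)) (map f xs) (g t)    ∎)
  where open ≡-Reasoning

Linked-route-join : {R : A ⊎ I → A ⊎ I → Set} (s : A ⊎ I) (xs : List I) {m : I} {ys : List I}
                    {t : A ⊎ I} → Linked R (route s xs (inj₂ m)) → Linked R (route (inj₂ m) ys t) →
                    Linked R (route s (xs ++ m ∷ ys) t)
Linked-route-join s []       (r ∷ [-]) l = r ∷ l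
Linked-route-join s (x ∷ xs) (r ∷ l)   l′ = r ∷ Linked-route-join (inj₂ x) xs l l′

route-unique : {xs : List I} {s t : A} → s ≢ t → Unique xs → Unique (route (inj₁ s) xs (inj₁ t))
route-unique {xs = xs} {s} {t} s≢t u = s-fresh ∷ Unique.++⁺ (Unique.map⁺ inj₂-injective u)
  ([] ∷ []) (Disjoint.sym (inj₁-inj₂-disjoint (t ∷ []) xs))
  where
  s-fresh : All (inj₁ s ≢_) (map inj₂ xs ++ inj₁ t ∷ [])
  s-fresh = All.∷ʳ⁺ (All.map⁺ (All.universal (λ _ ()) xs)) (s≢t ∘ inj₁-injective)

record Walk (R : A ⊎ I → A ⊎ I → Set) (s t : A ⊎ I) : Set where
  field
    interior : List I
    unique   : Unique interior
    linked   : Linked R (route s interior t)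
open Walk

size : {R : A ⊎ I → A ⊎ I → Set} {s t : A ⊎ I} → Walk R s t → ℕ
size w = length (interior w)

Walk-weaken : {R S : A ⊎ I → A ⊎ I → Set} {s t : A ⊎ I} →
              (∀ {x y} → R x y → S x y) → Walk R s t → Walk S s t
Walk-weaken R⊆S w = record
  { interior = interior w ; unique = unique w ; linked = Linked.map R⊆S (linked w) }

Walk-image : {R : A ⊎ I → A ⊎ I → Set} {s t : A ⊎ I}
             (g : A ⊎ I → B ⊎ J) (f : I → J) → Injective _≡_ _≡_ f →
             (∀ i → g (inj₂ i) ≡ inj₂ (f i)) → Walk R s t → Walk (Image g R) (g s) (g t)
Walk-image {s = s} {t} g f f-injective g-inj₂ w = record
  { interior = map f (interior w)
  ; unique   = Unique.map⁺ f-injective (unique w)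
  ; linked   = subst (Linked _) (map-route g f g-inj₂ s (interior w) t) (Linked-image g (linked w))
  }

PolePath : (Bool ⊎ I → Bool ⊎ I → Set) → Set
PolePath R = Walk R (inj₁ false) (inj₁ true)

series : (a b : Child) → PolePath (EdgeC a) → PolePath (EdgeC b) → PolePath (EdgeS (snode a b))
series a b wa wb = record
  { interior = interior left ++ middle ∷ interior right
  ; unique   = subst Unique (cong (λ zs → map inj₁ (interior wa) ++ middle ∷ zs)
                                  (sym (map-∘ (interior wb))))
                 (unique-inj₁-++-inj₂ (unique wa) (unique-inj₁-++-inj₂ ([] ∷ []) (unique wb)))
  ; linked   = Linked-route-join (inj₁ false) (interior left) (linked left) (linked right)
  }
  where
  middle : IntS (snode a b)
  middle = inj₂ (inj₁ tt)
  left : Walk (EdgeS (snode a b)) (inj₁ false) (inj₂ middle)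
  left = Walk-weaken inj₁ (Walk-image embLeft inj₁ inj₁-injective (λ _ → refl) wa)
  right : Walk (EdgeS (snode a b)) (inj₂ middle) (inj₁ true)
  right = Walk-weaken inj₂ (Walk-image embRight (inj₂ ∘ inj₂) (inj₂-injective ∘ inj₂-injective)
                                       (λ _ → refl) wb)

size-series : (a b : Child) (wa : PolePath (EdgeC a)) (wb : PolePath (EdgeC b)) →
              size (series a b wa wb) ≡ size wa + suc (size wb)
size-series a b wa wb = begin
  length (map inj₁ xs ++ inj₂ (inj₁ tt) ∷ map (inj₂ ∘ inj₂) ys)
    ≡⟨ length-++ (map inj₁ xs) ⟩
  length (map inj₁ xs) + suc (length (map (inj₂ ∘ inj₂) ys))
    ≡⟨ cong₂ (λ m n → m + suc n) (length-map inj₁ xs) (length-map (inj₂ ∘ inj₂) ys) ⟩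
  length xs + suc (length ys) ∎
  where
  open ≡-Reasoning
  xs : List (IntC a)
  xs = interior wa
  ys : List (IntC b)
  ys = interior wb

series-height : ∀ {hₐ h_b kₐ k_b} → hₐ ≤ 2 * kₐ → h_b ≤ 2 * k_b →
                2 + (hₐ ⊔ h_b) ≤ 2 * (kₐ + suc k_b)
series-height {hₐ} {h_b} {kₐ} {k_b} hₐ≤ h_b≤ = begin
  2 + (hₐ ⊔ h_b)          ≤⟨ +-monoʳ-≤ 2 (⊔-mono-≤ hₐ≤ h_b≤) ⟩
  2 + (2 * kₐ ⊔ 2 * k_b)  ≤⟨ +-monoʳ-≤ 2 (m⊔n≤m+n (2 * kₐ) (2 * k_b)) ⟩
  2 + (2 * kₐ + 2 * k_b)  ≡⟨ distribute kₐ k_b ⟩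
  2 * (kₐ + suc k_b)      ∎
  where
  open ≤-Reasoning
  distribute : ∀ m n → 2 + (2 * m + 2 * n) ≡ 2 * (m + suc n)
  distribute = solve-∀

LongPath : (Bool ⊎ I → Bool ⊎ I → Set) → ℕ → Set
LongPath R h = Σ[ w ∈ PolePath R ] h ≤ 2 * size w

parallel-head : (s : SNode) (ss : List SNode) → heightL ss ≤ heightS s →
                LongPath (EdgeS s) (suc (heightS s)) →
                LongPath (EdgeL (s ∷ ss)) (suc (heightL (s ∷ ss)))
parallel-head s ss ss≤s (w , bound) = Walk-weaken inj₁ w′ , (begin
  suc (heightS s ⊔ heightL ss)  ≡⟨ cong suc (m≥n⇒m⊔n≡m ss≤s) ⟩
  suc (heightS s)               ≤⟨ bound ⟩
  2 * size w                    ≡⟨ cong (2 *_) (sym (length-map inj₁ (interior w))) ⟩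
  2 * size w′                   ∎)
  where
  open ≤-Reasoning
  w′ : Walk (Image embHead (EdgeS s)) (inj₁ false) (inj₁ true)
  w′ = Walk-image embHead inj₁ inj₁-injective (λ _ → refl) w

parallel-tail : (s : SNode) (ss : List SNode) → heightS s ≤ heightL ss →
                LongPath (EdgeL ss) (suc (heightL ss)) →
                LongPath (EdgeL (s ∷ ss)) (suc (heightL (s ∷ ss)))
parallel-tail s ss s≤ss (w , bound) = Walk-weaken inj₂ w′ , (begin
  suc (heightS s ⊔ heightL ss)  ≡⟨ cong suc (m≤n⇒m⊔n≡n s≤ss) ⟩
  suc (heightL ss)              ≤⟨ bound ⟩
  2 * size w                    ≡⟨ cong (2 *_) (sym (length-map inj₂ (interior w))) ⟩
  2 * size w′                   ∎)
  where
  open ≤-Reasoning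
  w′ : Walk (Image embTail (EdgeL ss)) (inj₁ false) (inj₁ true)
  w′ = Walk-image embTail inj₂ inj₂-injective (λ _ → refl) w

mutual
  longPathC : (c : Child) → LongPath (EdgeC c) (heightC c)
  longPathC qleaf      = record { interior = [] ; unique = [] ; linked = inj₁ (refl , refl) ∷ [-] }
                       , z≤n
  longPathC (pchild p) = longPathP p

  longPathS : (s : SNode) → LongPath (EdgeS s) (suc (heightS s))
  longPathS (snode a b) with longPathC a | longPathC b
  ... | wa , hₐ≤ | wb , h_b≤ = series a b wa wb
    , subst (λ k → suc (heightS (snode a b)) ≤ 2 * k) (sym (size-series a b wa wb))
            (series-height {kₐ = size wa} {k_b = size wb} hₐ≤ h_b≤)

  longPathL : (s : SNode) (ss : List SNode) → LongPath (EdgeL (s ∷ ss)) (suc (heightL (s ∷ ss)))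
  longPathL s [] = parallel-head s [] z≤n (longPathS s)
  longPathL s ss@(s′ ∷ ss′) with ≤-total (heightL ss) (heightS s)
  ... | inj₁ ss≤s = parallel-head s ss ss≤s (longPathS s)
  ... | inj₂ s≤ss = parallel-tail s ss s≤ss (longPathL s′ ss′)

  longPathP : (p : PNode) → LongPath (EdgeP p) (heightP p)
  longPathP (pnode s ss) with longPathL s ss
  ... | w , bound = Walk-weaken inj₂ w , bound

PolePath⇒Path : ∀ {n} {E : Fin n → Fin n → Set} {R : Bool ⊎ I → Bool ⊎ I → Set}
                (f : Bool ⊎ I → Fin n) → Injective _≡_ _≡_ f → (∀ {x y} → R x y → E (f x) (f y)) →
                (w : PolePath R) → Σ[ p ∈ Path E ] pathLength p ≡ suc (size w)
PolePath⇒Path {I = I} {E = E} f f-injective f-adjacent w = path , (begin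
  length (map f (map inj₂ xs ++ inj₁ true ∷ []))  ≡⟨ length-map f (map inj₂ xs ++ inj₁ true ∷ []) ⟩
  length (map inj₂ xs ++ inj₁ true ∷ [])          ≡⟨ length-++ (map inj₂ xs) ⟩
  length (map inj₂ xs) + 1                        ≡⟨ cong (_+ 1) (length-map inj₂ xs) ⟩
  length xs + 1                                   ≡⟨ +-comm (length xs) 1 ⟩
  suc (length xs)                                 ∎)
  where
  open ≡-Reasoning
  xs : List I
  xs = interior w
  path : Path E
  path = record
    { start  = f (inj₁ false)
    ; rest   = map f (map inj₂ xs ++ inj₁ true ∷ [])
    ; unique = Unique.map⁺ f-injective (route-unique (λ ()) (unique w))
    ; linked = Linked.map⁺ (Linked.map f-adjacent (linked w))
    }

height-bound : ∀ {h k ℓ} → h ≤ 2 * k → suc k ≤ ℓ → h ≤ 2 * ℓ ∸ 2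
height-bound {h} {k} {ℓ} h≤2k k<ℓ = begin
  h                  ≤⟨ h≤2k ⟩
  2 * k              ≡⟨ sym (m+n∸m≡n 2 (2 * k)) ⟩
  2 + 2 * k ∸ 2      ≡⟨ cong (_∸ 2) (sym (*-suc 2 k)) ⟩
  2 * suc k ∸ 2      ≤⟨ ∸-monoˡ-≤ 2 (*-monoʳ-≤ 2 k<ℓ) ⟩
  2 * ℓ ∸ 2          ∎
  where open ≤-Reasoning

lemma22 : ∀ {n : ℕ} {E : Fin n → Fin n → Set} → TwoTree n E →
    (ℓ : ℕ) → IsLongestPathLength E ℓ →
    (T : PNode) → IsSPQTreeOf T (finGraph n E) →
    heightP T ≤ 2 * ℓ ∸ 2
lemma22 _ ℓ (_ , longest) T (iso , adjacent) with longPathP T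
... | w , h≤2k with PolePath⇒Path (Inverse.to iso) (Injection.injective (↔⇒↣ iso))
                                  (Equivalence.to (adjacent _ _)) w
...   | path , length≡ = height-bound h≤2k (subst (_≤ ℓ) length≡ (longest path))
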